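{- Let $L=(X,\le)$ be a finite upper locally distributive lattice generated by a Chip Firing Game $CFG(G,\mathcal{O})$ that reaches a fixed point, and identify the elements of $L$ with the configurations of the game. Then the map $\kappa:M\to V(G)\times\mathbb{N}$ given by $\kappa(m)=\big(\vartheta(c,c'),\,s_{c'}(\vartheta(c,c'))\big)$, where $c,c'$ are any configurations with $c\prec c'$ and $\mathfrak{m}(c,c')=m$, is well-defined and injective.
   Context: Lattice notions: $x\prec y$ means $y$ covers $x$; $M$ is the set of meet-irreducibles (elements with exactly one upper cover), $M_x=\{m\in M:x\le m\}$; $L$ is upper locally distributive if each interval $[x,x^{+}]$ ($x\ne\mathbf{1}$, $x^{+}$ the join of the upper covers of $x$) is Boolean; then for each cover $x\prec y$ the set $M_x\setminus M_y$ has exactly one element $\mathfrak{m}(x,y)$. Chip Firing Games: $G$ a finite directed multigraph with out-degrees $deg^{+}(v)$; a sink is a vertex all of whose outgoing edges are loops. Configurations are maps $V(G)\to\mathbb{N}$; a non-sink $v$ is firable in $c$ if $c(v)\ge deg^{+}(v)$, and firing moves one chip from $v$ along each outgoing edge. $CFG(G,\mathcal{O})$ is the set of configurations reachable from $\mathcal{O}$, ordered by reachability; when no infinite firing sequence exists it is a lattice in which $c\prec c'$ exactly when $c'$ is obtained from $c$ by firing a single vertex, denoted $\vartheta(c,c')$. The shot-vector $s_c:V(G)\to\mathbb{N}$ of a configuration $c$ assigns to each vertex the number of times it is fired in an execution from $\mathcal{O}$ to $c$ (independent of the execution). -}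

module Defs where

open import Data.Nat using (ℕ; zero; suc; _+_; _∸_; _≤_; _<_)
open import Data.Fin using (Fin; _≟_)
open import Data.Vec using (Vec; lookup; tabulate)
open import Data.Vec.Functional using () renaming (foldr to vfoldr)
open import Data.Product using (Σ; ∃; ∃-syntax; _×_; _,_)
open import Relation.Nullary using (¬_; yes; no)
open import Relation.Binary.PropositionalEquality using (_≡_; _≢_)
open import Relation.Binary.Construct.Closure.ReflexiveTransitive using (Star)

-- A finite directed multigraph on vertex set Fin n, given by edge
-- multiplicities: E v w = number of edges from v to w (loops allowed).
Graph : ℕ → Set
Graph n = Fin n → Fin n → ℕ

deg⁺ : ∀ {n} → Graph n → Fin n → ℕ
deg⁺ {n} E v = vfoldr _+_ 0 (λ w → E v w)

IsSink : ∀ {n} → Graph n → Fin n → Set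
IsSink E v = ∀ w → w ≢ v → E v w ≡ 0

Config : ℕ → Set
Config n = Vec ℕ n

Firable : ∀ {n} → Graph n → Config n → Fin n → Set
Firable E c v = (¬ IsSink E v) × (deg⁺ E v ≤ lookup c v)

-- result of firing v in c: one chip leaves v along each outgoing edge
fire : ∀ {n} → Graph n → Config n → Fin n → Config n
fire E c v = tabulate λ w → (lookup c w + E v w) ∸ lost w
  where
  lost : _ → ℕ
  lost w with w ≟ v
  ... | yes _ = deg⁺ E v
  ... | no  _ = 0

Fires : ∀ {n} → Graph n → Config n → Fin n → Config n → Set
Fires E c v c' = Firable E c v × (c' ≡ fire E c v)

Step : ∀ {n} → Graph n → Config n → Config n → Set
Step E c c' = ∃[ v ] Fires E c v c'

Reach : ∀ {n} → Graph n → Config n → Config n → Set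
Reach E = Star (Step E)

-- the game reaches a fixed point: no infinite firing sequence from O
Terminating : ∀ {n} → Graph n → Config n → Set
Terminating E O =
  ¬ (Σ (ℕ → Config _) λ f → (f 0 ≡ O) × (∀ i → Step E (f i) (f (suc i))))

data Exec {n} (E : Graph n) (c : Config n) : Config n → Set where
  start : Exec E c c
  _▸_   : ∀ {d e} → Exec E c d → ∃[ v ] Fires E d v e → Exec E c e

shots : ∀ {n} {E : Graph n} {c c' : Config n} → Exec E c c' → Fin n → ℕ
shots start u = 0
shots (p ▸ (v , _)) u with v ≟ u
... | yes _ = suc (shots p u)
... | no  _ = shots p u

-- the lattice L = CFG(G,O): elements are configurations reachable from O
module CFG {n : ℕ} (E : Graph n) (O : Config n) where

  InL : Config n → Set
  InL c = Reach E O c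

  _≤L_ : Config n → Config n → Set
  c ≤L c' = Reach E c c'

  _<L_ : Config n → Config n → Set
  c <L c' = (c ≤L c') × (c ≢ c')

  _≺_ : Config n → Config n → Set
  c ≺ c' = InL c × InL c' × (c <L c') ×
           (∀ z → InL z → c <L z → z ≤L c' → z ≡ c')

  IsMeetIrr : Config n → Set
  IsMeetIrr m = InL m × (∃[ u ] ((m ≺ u) × (∀ u' → m ≺ u' → u' ≡ u)))

  InM : Config n → Config n → Set
  InM x m = IsMeetIrr m × (x ≤L m)

  -- m ∈ M_c ∖ M_c'  (i.e. m = 𝔪(c,c') for a cover c ≺ c')
  IsFrak : Config n → Config n → Config n → Set
  IsFrak c c' m = InM c m × ¬ (c' ≤L m)

-- Everything is reduced to the combinatorics of firing words.
-- (1) Local firing rules: firing v strictly lowers the chips on v (so the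
--     fired vertex is determined by the result), firing another vertex keeps
--     v firable, and two firable vertices may be fired in either order.
-- (2) Exchange lemma: runs from c by words xs and ys are completed to a
--     common configuration by the multiset differences ys ∖ xs and xs ∖ ys.
-- (3) A terminating game reaches no recurrent set of configurations; hence
--     there is no nonempty cycle and no pair of disjoint nonempty parallel
--     runs, so the letter counts of a run from O depend only on its end
--     (the shot vector is well defined).
-- (4) In L, firing a firable vertex of m gives an upper cover; hence a
--     meet-irreducible m has exactly one firable vertex v, and for every
--     cover c ≺ c' with 𝔪(c,c') = m the vertex fired is v and s_{c'}(v) =
--     s_m(v) + 1.  So κ(m) depends on m only, and two meet-irreducibles with
--     equal κ are joined by runs avoiding their firable vertex, which are
--     empty: κ is injective.
module Submission where

open import Defs
open import Data.Nat using (ℕ; zero; suc; _+_; _∸_; _≤_)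
open import Data.Nat.Properties
  using ( ≤-trans; ≤-reflexive; ≤-antisym; ≤-total; m≤m+n; m≤n+m
        ; +-monoʳ-≤; +-monoˡ-≤; +-cancelˡ-≤; +-cancelʳ-≤; +-cancelˡ-≡
        ; +-comm; +-assoc; +-identityʳ; n≤0⇒n≡0; 1+n≢0; suc-injective
        ; m∸n+n≡m; +-∸-comm; ∸-+-assoc; m+n∸m≡n; 0∸n≡0
        ; m≤n⇒m∸n≡0; m∸n≡0⇒m≤n; m+n≡0⇒n≡0 )
open import Data.Fin using (Fin; _≟_) renaming (zero to fzero; suc to fsuc)
open import Data.Vec using (Vec; lookup; tabulate)
open import Data.Vec.Properties using (lookup∘tabulate; tabulate∘lookup; tabulate-cong)
open import Data.Vec.Functional using () renaming (foldr to vfoldr)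
open import Data.List using (List; []; _∷_; _++_)
open import Data.List.Properties using (++-conicalˡ; ++-conicalʳ; ∷-injectiveʳ)
open import Data.Product using (Σ; ∃; ∃-syntax; _×_; _,_; proj₁; proj₂)
open import Data.Sum using (_⊎_; inj₁; inj₂)
open import Data.Empty using (⊥; ⊥-elim)
open import Relation.Nullary using (¬_; yes; no)
open import Relation.Binary.PropositionalEquality
open import Relation.Binary.Construct.Closure.ReflexiveTransitive using (ε; _◅_)

lookup-ext : ∀ {n} {A : Set} (xs ys : Vec A n) → (∀ i → lookup xs i ≡ lookup ys i) → xs ≡ ys
lookup-ext xs ys same =
  trans (sym (tabulate∘lookup xs)) (trans (tabulate-cong same) (tabulate∘lookup ys))

-- Reading an entry of a vector known to be a tabulation (lets us read
-- entries of 'fire', whose tabulated function is local to its definition).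
lookup-tabulated : ∀ {n} {f : Fin n → ℕ} (xs : Vec ℕ n) → xs ≡ tabulate f → ∀ i → lookup xs i ≡ f i
lookup-tabulated xs refl i = lookup∘tabulate _ i

term≤sum : ∀ {n} (f : Fin n → ℕ) i → f i ≤ vfoldr _+_ 0 f
term≤sum f fzero    = m≤m+n _ _
term≤sum f (fsuc i) = ≤-trans (term≤sum (λ k → f (fsuc k)) i) (m≤n+m _ (f fzero))

twoTerms≤sum : ∀ {n} (f : Fin n → ℕ) i j → i ≢ j → f i + f j ≤ vfoldr _+_ 0 f
twoTerms≤sum f fzero fzero i≢j = ⊥-elim (i≢j refl)
twoTerms≤sum f fzero (fsuc j) _ = +-monoʳ-≤ (f fzero) (term≤sum (λ k → f (fsuc k)) j)
twoTerms≤sum f (fsuc i) fzero _ =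
  subst (_≤ f fzero + vfoldr _+_ 0 (λ k → f (fsuc k))) (+-comm (f fzero) (f (fsuc i)))
        (+-monoʳ-≤ (f fzero) (term≤sum (λ k → f (fsuc k)) i))
twoTerms≤sum f (fsuc i) (fsuc j) i≢j =
  ≤-trans (twoTerms≤sum (λ k → f (fsuc k)) i j (λ e → i≢j (cong fsuc e))) (m≤n+m _ (f fzero))

-- (1) Local rules of firing

module Firing {n : ℕ} (E : Graph n) where

  fire-self : ∀ c v → lookup (fire E c v) v ≡ lookup c v + E v v ∸ deg⁺ E v
  fire-self c v rewrite lookup-tabulated (fire E c v) refl v with v ≟ v
  ... | yes _   = refl
  ... | no v≢v = ⊥-elim (v≢v refl)

  fire-other : ∀ c v w → w ≢ v → lookup (fire E c v) w ≡ lookup c w + E v w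
  fire-other c v w w≢v rewrite lookup-tabulated (fire E c v) refl w with w ≟ v
  ... | yes w≡v = ⊥-elim (w≢v w≡v)
  ... | no _    = refl

  -- Firing a (non-sink) vertex strictly lowers its chips: otherwise its
  -- loops alone would account for its whole out-degree, making it a sink.
  firing-lowers : ∀ c v → Firable E c v → ¬ (lookup c v ≤ lookup (fire E c v) v)
  firing-lowers c v (notSink , deg≤c) c≤fired = notSink sink
    where
    loops-cover-deg : deg⁺ E v ≤ E v v
    loops-cover-deg = +-cancelˡ-≤ (lookup c v) _ _
      (subst (lookup c v + deg⁺ E v ≤_) (m∸n+n≡m (≤-trans deg≤c (m≤m+n _ _)))
        (+-monoˡ-≤ (deg⁺ E v) (subst (lookup c v ≤_) (fire-self c v) c≤fired)))
    sink : IsSink E v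
    sink w w≢v = n≤0⇒n≡0 (+-cancelʳ-≤ (E v v) (E v w) 0
                   (≤-trans (twoTerms≤sum (E v) w v w≢v) loops-cover-deg))

  fire-changes : ∀ c v → Firable E c v → c ≢ fire E c v
  fire-changes c v fv c≡fired = firing-lowers c v fv (≤-reflexive (cong (λ x → lookup x v) c≡fired))

  fire-injective : ∀ c v w → Firable E c v → fire E c v ≡ fire E c w → v ≡ w
  fire-injective c v w fv same with v ≟ w
  ... | yes v≡w = v≡w
  ... | no v≢w  = ⊥-elim (firing-lowers c v fv
        (subst (lookup c v ≤_) (cong (λ x → lookup x v) (sym same))
          (subst (lookup c v ≤_) (sym (fire-other c w v v≢w)) (m≤m+n _ _))))

  -- Firing another vertex only adds chips to v, so v stays firable.
  firable-persists : ∀ c v y → Firable E c v → y ≢ v → Firable E (fire E c y) v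
  firable-persists c v y (notSink , deg≤c) y≢v =
    notSink , subst (deg⁺ E v ≤_) (sym (fire-other c y v (λ e → y≢v (sym e)))) (≤-trans deg≤c (m≤m+n _ _))

  fire-self-other : ∀ c x w → Firable E c x → x ≢ w →
                    lookup (fire E (fire E c x) w) x ≡ lookup (fire E (fire E c w) x) x
  fire-self-other c x w (_ , deg≤c) x≢w = begin
    lookup (fire E (fire E c x) w) x               ≡⟨ fire-other (fire E c x) w x x≢w ⟩
    lookup (fire E c x) x + E w x                  ≡⟨ cong (_+ E w x) (fire-self c x) ⟩
    lookup c x + E x x ∸ deg⁺ E x + E w x          ≡⟨ sym (+-∸-comm (E w x) (≤-trans deg≤c (m≤m+n _ _))) ⟩
    lookup c x + E x x + E w x ∸ deg⁺ E x          ≡⟨ cong (_∸ deg⁺ E x) (swap₂₃ (lookup c x) (E x x) (E w x)) ⟩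
    lookup c x + E w x + E x x ∸ deg⁺ E x          ≡⟨ cong (λ t → t + E x x ∸ deg⁺ E x) (sym (fire-other c w x x≢w)) ⟩
    lookup (fire E c w) x + E x x ∸ deg⁺ E x       ≡⟨ sym (fire-self (fire E c w) x) ⟩
    lookup (fire E (fire E c w) x) x               ∎
    where
    open ≡-Reasoning
    swap₂₃ : ∀ a b d → a + b + d ≡ a + d + b
    swap₂₃ a b d = trans (+-assoc a b d) (trans (cong (a +_) (+-comm b d)) (sym (+-assoc a d b)))

  fire-commute : ∀ c v w → Firable E c v → Firable E c w → v ≢ w →
                 fire E (fire E c v) w ≡ fire E (fire E c w) v
  fire-commute c v w fv fw v≢w = lookup-ext _ _ entry
    where
    open ≡-Reasoning
    entry : ∀ x → lookup (fire E (fire E c v) w) x ≡ lookup (fire E (fire E c w) v) x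
    entry x with x ≟ v | x ≟ w
    ... | yes refl | yes refl = ⊥-elim (v≢w refl)
    ... | yes refl | no x≢w   = fire-self-other c x w fv x≢w
    ... | no x≢v   | yes refl = sym (fire-self-other c x v fw x≢v)
    ... | no x≢v   | no x≢w   = begin
      lookup (fire E (fire E c v) w) x   ≡⟨ fire-other (fire E c v) w x x≢w ⟩
      lookup (fire E c v) x + E w x      ≡⟨ cong (_+ E w x) (fire-other c v x x≢v) ⟩
      lookup c x + E v x + E w x         ≡⟨ +-assoc (lookup c x) (E v x) (E w x) ⟩
      lookup c x + (E v x + E w x)       ≡⟨ cong (lookup c x +_) (+-comm (E v x) (E w x)) ⟩
      lookup c x + (E w x + E v x)       ≡⟨ sym (+-assoc (lookup c x) (E w x) (E v x)) ⟩
      lookup c x + E w x + E v x         ≡⟨ cong (_+ E v x) (sym (fire-other c w x x≢w)) ⟩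
      lookup (fire E c w) x + E v x      ≡⟨ sym (fire-other (fire E c w) v x x≢v) ⟩
      lookup (fire E (fire E c w) v) x   ∎

-- Firing words as multisets of vertices

module Words {n : ℕ} where

  Word : Set
  Word = List (Fin n)

  ind : Fin n → Fin n → ℕ
  ind x u with x ≟ u
  ... | yes _ = 1
  ... | no _  = 0

  occ : Word → Fin n → ℕ
  occ []       u = 0
  occ (x ∷ xs) u = ind x u + occ xs u

  remove : Fin n → Word → Word
  remove v [] = []
  remove v (y ∷ ys) with y ≟ v
  ... | yes _ = ys
  ... | no _  = y ∷ remove v ys

  _∖_ : Word → Word → Word
  xs ∖ []       = xs
  xs ∖ (y ∷ ys) = remove y xs ∖ ys

  Disjoint : Word → Word → Set
  Disjoint p q = ∀ u → occ p u ≡ 0 ⊎ occ q u ≡ 0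

  ind-self : ∀ x → ind x x ≡ 1
  ind-self x with x ≟ x
  ... | yes _   = refl
  ... | no x≢x = ⊥-elim (x≢x refl)

  ind-other : ∀ x u → x ≢ u → ind x u ≡ 0
  ind-other x u x≢u with x ≟ u
  ... | yes x≡u = ⊥-elim (x≢u x≡u)
  ... | no _    = refl

  occ-head : ∀ x xs → occ (x ∷ xs) x ≢ 0
  occ-head x xs rewrite ind-self x = 1+n≢0

  occ-++ : ∀ xs ys u → occ (xs ++ ys) u ≡ occ xs u + occ ys u
  occ-++ []       ys u = refl
  occ-++ (x ∷ xs) ys u rewrite occ-++ xs ys u = sym (+-assoc (ind x u) (occ xs u) (occ ys u))

  occ-snoc : ∀ xs v u → occ (xs ++ v ∷ []) u ≡ occ xs u + ind v u
  occ-snoc xs v u = trans (occ-++ xs (v ∷ []) u) (cong (occ xs u +_) (+-identityʳ (ind v u)))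

  occ-snoc-self : ∀ xs v → occ (xs ++ v ∷ []) v ≡ suc (occ xs v)
  occ-snoc-self xs v = trans (occ-snoc xs v v) (trans (cong (occ xs v +_) (ind-self v)) (+-comm (occ xs v) 1))

  occ-cancel-prefix : ∀ α xs ys → (∀ u → occ (α ++ xs) u ≡ occ (α ++ ys) u) → ∀ u → occ xs u ≡ occ ys u
  occ-cancel-prefix α xs ys same u =
    +-cancelˡ-≡ (occ α u) _ _ (trans (sym (occ-++ α xs u)) (trans (same u) (occ-++ α ys u)))

  occ-remove : ∀ y xs u → occ (remove y xs) u ≡ occ xs u ∸ ind y u
  occ-remove y []       u = sym (0∸n≡0 (ind y u))
  occ-remove y (x ∷ xs) u with x ≟ y
  ... | yes refl = sym (m+n∸m≡n (ind x u) (occ xs u))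
  ... | no x≢y with y ≟ u
  ...   | no y≢u   = cong (ind x u +_) (trans (occ-remove y xs u) (cong (occ xs u ∸_) (ind-other y u y≢u)))
  ...   | yes refl rewrite ind-other x y x≢y = trans (occ-remove y xs y) (cong (occ xs y ∸_) (ind-self y))

  occ-∖ : ∀ xs ys u → occ (xs ∖ ys) u ≡ occ xs u ∸ occ ys u
  occ-∖ xs []       u = refl
  occ-∖ xs (y ∷ ys) u rewrite occ-∖ (remove y xs) ys u | occ-remove y xs u =
    ∸-+-assoc (occ xs u) (ind y u) (occ ys u)

  remove-absent : ∀ y xs → occ xs y ≡ 0 → remove y xs ≡ xs
  remove-absent y []       _ = refl
  remove-absent y (x ∷ xs) absent with x ≟ y
  ... | yes refl = ⊥-elim (1+n≢0 absent)
  ... | no _     = cong (x ∷_) (remove-absent y xs absent)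

  nil-∖ : ∀ ys → [] ∖ ys ≡ []
  nil-∖ []       = refl
  nil-∖ (y ∷ ys) = nil-∖ ys

  ∖-cons-absent : ∀ x xs ys → occ ys x ≡ 0 → (x ∷ xs) ∖ ys ≡ x ∷ (xs ∖ ys)
  ∖-cons-absent x xs []       _      = refl
  ∖-cons-absent x xs (y ∷ ys) absent with x ≟ y
  ... | yes refl = ⊥-elim (occ-head x ys absent)
  ... | no x≢y rewrite ind-other y x (λ e → x≢y (sym e)) = ∖-cons-absent x (remove y xs) ys absent

  ∖-cons-present : ∀ x xs ys → occ ys x ≢ 0 → (x ∷ xs) ∖ ys ≡ xs ∖ remove x ys
  ∖-cons-present x xs []       present = ⊥-elim (present refl)
  ∖-cons-present x xs (y ∷ ys) present with x ≟ y | y ≟ x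
  ... | yes refl | yes _   = refl
  ... | yes refl | no y≢x  = ⊥-elim (y≢x refl)
  ... | no x≢y   | yes y≡x = ⊥-elim (x≢y (sym y≡x))
  ... | no _     | no _    = ∖-cons-present x (remove y xs) ys present

  Disjoint-sym : ∀ {p q} → Disjoint p q → Disjoint q p
  Disjoint-sym dj u with dj u
  ... | inj₁ e = inj₂ e
  ... | inj₂ e = inj₁ e

  ∖-disjoint : ∀ xs ys → Disjoint ys xs → xs ∖ ys ≡ xs
  ∖-disjoint xs []       _  = refl
  ∖-disjoint xs (y ∷ ys) dj with dj y
  ... | inj₁ e = ⊥-elim (occ-head y ys e)
  ... | inj₂ e rewrite remove-absent y xs e = ∖-disjoint xs ys tail-disjoint
    where
    tail-disjoint : Disjoint ys xs
    tail-disjoint u with dj u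
    ... | inj₁ e' = inj₁ (m+n≡0⇒n≡0 (ind y u) e')
    ... | inj₂ e' = inj₂ e'

  differences-disjoint : ∀ xs ys → Disjoint (ys ∖ xs) (xs ∖ ys)
  differences-disjoint xs ys u with ≤-total (occ ys u) (occ xs u)
  ... | inj₁ ys≤xs = inj₁ (trans (occ-∖ ys xs u) (m≤n⇒m∸n≡0 ys≤xs))
  ... | inj₂ xs≤ys = inj₂ (trans (occ-∖ xs ys u) (m≤n⇒m∸n≡0 xs≤ys))

  occ-singleton : ∀ ls v → (∀ u → occ ls u ≡ occ (v ∷ []) u) → ls ≡ v ∷ []
  occ-singleton []      v same = ⊥-elim (occ-head v [] (sym (same v)))
  occ-singleton (x ∷ t) v same with x ≟ v
  ... | no x≢v = ⊥-elim (occ-head x t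
          (trans (same x) (trans (+-identityʳ (ind v x)) (ind-other v x (λ e → x≢v (sym e))))))
  ... | yes refl = cong (x ∷_) (empty t (λ u → +-cancelˡ-≡ (ind x u) _ _ (same u)))
    where
    empty : ∀ t → (∀ u → occ t u ≡ 0) → t ≡ []
    empty []      _    = refl
    empty (y ∷ t) none = ⊥-elim (occ-head y t (none y))

-- (2) Runs labelled by firing words, and the exchange lemma

module Runs {n : ℕ} (E : Graph n) where
  open Firing E
  open Words {n}

  data Run : Config n → Word → Config n → Set where
    []  : ∀ {c} → Run c [] c
    _∷_ : ∀ {c v c₁ xs c'} → Fires E c v c₁ → Run c₁ xs c' → Run c (v ∷ xs) c'

  run-++ : ∀ {a xs b ys c} → Run a xs b → Run b ys c → Run a (xs ++ ys) c
  run-++ []      r = r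
  run-++ (f ∷ r) r' = f ∷ run-++ r r'

  run-empty : ∀ {a xs b} → Run a xs b → xs ≡ [] → a ≡ b
  run-empty [] _ = refl

  fromReach : ∀ {a b} → Reach E a b → Σ Word λ xs → Run a xs b
  fromReach ε             = [] , []
  fromReach ((v , f) ◅ s) = let (xs , r) = fromReach s in v ∷ xs , f ∷ r

  toReach : ∀ {a xs b} → Run a xs b → Reach E a b
  toReach []                = ε
  toReach (_∷_ {v = v} f r) = (v , f) ◅ toReach r

  trace : ∀ {a b} → Exec E a b → Word
  trace start         = []
  trace (p ▸ (v , _)) = trace p ++ v ∷ []

  trace-run : ∀ {a b} (p : Exec E a b) → Run a (trace p) b
  trace-run start         = []
  trace-run (p ▸ (_ , f)) = run-++ (trace-run p) (f ∷ [])

  shots-step : ∀ {a d b} (p : Exec E a d) (v : Fin n) (f : Fires E d v b) u →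
               shots (p ▸ (v , f)) u ≡ ind v u + shots p u
  shots-step p v f u with v ≟ u
  ... | yes _ = refl
  ... | no _  = refl

  shots-trace : ∀ {a b} (p : Exec E a b) u → shots p u ≡ occ (trace p) u
  shots-trace start u = refl
  shots-trace (p ▸ (v , f)) u = begin
    shots (p ▸ (v , f)) u       ≡⟨ shots-step p v f u ⟩
    ind v u + shots p u         ≡⟨ cong (ind v u +_) (shots-trace p u) ⟩
    ind v u + occ (trace p) u   ≡⟨ +-comm (ind v u) _ ⟩
    occ (trace p) u + ind v u   ≡⟨ sym (occ-snoc (trace p) v u) ⟩
    occ (trace p ++ v ∷ []) u   ∎
    where open ≡-Reasoning

  push-firing : ∀ {c v ys b} → Firable E c v → Run c ys b →
    (occ ys v ≡ 0 × Firable E b v × Run (fire E c v) ys (fire E b v))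
    ⊎ (occ ys v ≢ 0 × Run (fire E c v) (remove v ys) b)
  push-firing fv [] = inj₁ (refl , fv , [])
  push-firing {c} {v} fv (_∷_ {v = y} (fy , refl) r) with y ≟ v
  ... | yes refl = inj₂ (1+n≢0 , r)
  ... | no y≢v with push-firing (firable-persists c v y fv y≢v) r
  ...   | inj₁ (absent , fb , r') = inj₁ (absent , fb , swapped ∷ r')
    where swapped = firable-persists c y v fy (λ e → y≢v (sym e)) , fire-commute c y v fy fv y≢v
  ...   | inj₂ (present , r') = inj₂ (present , swapped ∷ r')
    where swapped = firable-persists c y v fy (λ e → y≢v (sym e)) , fire-commute c y v fy fv y≢v

  -- Exchange lemma (local confluence iterated): two runs from c can be
  -- completed to a common configuration by the multiset differences.
  exchange : ∀ {c xs a ys b} → Run c xs a → Run c ys b →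
             Σ (Config n) λ e → Run a (ys ∖ xs) e × Run b (xs ∖ ys) e
  exchange {ys = ys} {b = b} [] rb rewrite nil-∖ ys = b , rb , []
  exchange {ys = ys} (_∷_ {v = x} {xs = xs} (fx , refl) ra) rb with push-firing fx rb
  ... | inj₁ (absent , fbx , rb') with exchange ra rb'
  ...   | e , r₁ , r₂ rewrite remove-absent x ys absent | ∖-cons-absent x xs ys absent =
          e , r₁ , (fbx , refl) ∷ r₂
  exchange {ys = ys} (_∷_ {v = x} {xs = xs} (fx , refl) ra) rb | inj₂ (present , rb')
    with exchange ra rb'
  ...   | e , r₁ , r₂ rewrite ∖-cons-present x xs ys present = e , r₁ , r₂

-- (3) Terminating games and (4) the lattice L

module TerminatingGame {n : ℕ} (E : Graph n) (O : Config n) (term : Terminating E O) where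
  open Firing E
  open Words {n}
  open Runs E
  open CFG E O

  Recurrent : (Config n → Set) → Set
  Recurrent I = ∀ {c} → I c →
    Σ (Config n) λ d → Σ (Fin n) λ v → Σ Word λ vs → Run c (v ∷ vs) d × I d

  -- No recurrent set is reachable: following the recurrence from O would
  -- give an infinite firing sequence.
  recurrent-unreachable : ∀ {I} → Recurrent I → ∀ {α c} → Run O α c → I c → ⊥
  recurrent-unreachable {I} recur {α} {c} rα inI = term (walk , refl , walk-steps)
    where
    -- a position: a word still to be run before re-entering I
    Pos : Config n → Set
    Pos x = Σ Word λ r → Σ (Config n) λ d → Run x r d × I d
    advance : ∀ {x} → Pos x → Σ (Config n) λ x' → Step E x x' × Pos x'
    advance (_ ∷ r , d , f ∷ rr , inI) = _ , (_ , f) , r , d , rr , inI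
    advance ([] , d , [] , inI) with recur inI
    ... | d' , v , vs , f ∷ rr , inI' = _ , (v , f) , vs , d' , rr , inI'
    position : ℕ → Σ (Config n) Pos
    position zero    = O , α , c , rα , inI
    position (suc i) = let (x' , _ , p') = advance (proj₂ (position i)) in x' , p'
    walk : ℕ → Config n
    walk i = proj₁ (position i)
    walk-steps : ∀ i → Step E (walk i) (walk (suc i))
    walk-steps i = proj₁ (proj₂ (advance (proj₂ (position i))))

  cycle-empty : ∀ {α c ρ} → Run O α c → Run c ρ c → ρ ≡ []
  cycle-empty {ρ = []}     _  _  = refl
  cycle-empty {ρ = v ∷ vs} rα rρ =
    ⊥-elim (recurrent-unreachable {I = λ d → Run d (v ∷ vs) d} (λ {d} r → d , v , vs , r , r) rα rρ)

  -- Parallel runs with disjoint words from a reachable configuration are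
  -- empty: exchanging them reproduces the same pair one round later.
  parallel-disjoint-empty : ∀ {α c e p q} → Run O α c → Run c p e → Run c q e → Disjoint p q → q ≡ []
  parallel-disjoint-empty {q = []} _ _ _ _ = refl
  parallel-disjoint-empty {e = e} {p = p} {q = v ∷ vs} rα rp rq dj =
    ⊥-elim (recurrent-unreachable recur rα (e , rp , rq))
    where
    I : Config n → Set
    I d = Σ (Config n) λ e' → Run d p e' × Run d (v ∷ vs) e'
    recur : Recurrent I
    recur (e₁ , rp₁ , rq₁) with exchange rp₁ rq₁
    ... | e₂ , r₁ , r₂ = e₁ , v , vs , rq₁ , e₂ , again p (v ∷ vs) (Disjoint-sym {p} {v ∷ vs} dj) r₂
                                                  , again (v ∷ vs) p dj r₁
      where
      again : ∀ xs ys → Disjoint ys xs → Run e₁ (xs ∖ ys) e₂ → Run e₁ xs e₂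
      again xs ys dj' = subst (λ w → Run e₁ w e₂) (∖-disjoint xs ys dj')

  shot-invariance : ∀ {α β c} → Run O α c → Run O β c → ∀ u → occ α u ≡ occ β u
  shot-invariance {α} {β} rα rβ u with exchange rα rβ
  ... | e , r₁ , r₂ = ≤-antisym (m∸n≡0⇒m≤n (no-excess α β r₁ r₂ (differences-disjoint α β)))
                                (m∸n≡0⇒m≤n (no-excess β α r₂ r₁ (Disjoint-sym {β ∖ α} {α ∖ β} (differences-disjoint α β))))
    where
    no-excess : ∀ xs ys {e} → Run _ (ys ∖ xs) e → Run _ (xs ∖ ys) e →
                Disjoint (ys ∖ xs) (xs ∖ ys) → occ xs u ∸ occ ys u ≡ 0
    no-excess xs ys r r' dj =
      trans (sym (occ-∖ xs ys u)) (cong (λ w → occ w u) (parallel-disjoint-empty rα r r' dj))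

  reach-antisym : ∀ {a b} → InL a → a ≤L b → b ≤L a → a ≡ b
  reach-antisym inL ab ba with fromReach inL | fromReach ab | fromReach ba
  ... | _ , rα | σ , rσ | τ , rτ = run-empty rσ (++-conicalˡ σ τ (cycle-empty rα (run-++ rσ rτ)))

  firing-covers : ∀ {m v} → InL m → Firable E m v → m ≺ fire E m v
  firing-covers {m} {v} inL fv =
    inL , toReach (run-++ rα once) , (toReach once , fire-changes m v fv) , nothing-between
    where
    α = proj₁ (fromReach inL)
    rα = proj₂ (fromReach inL)
    once : Run m (v ∷ []) (fire E m v)
    once = (fv , refl) ∷ []
    nothing-between : ∀ z → InL z → m <L z → z ≤L fire E m v → z ≡ fire E m v
    nothing-between z _ (mz , m≢z) zf with fromReach mz | fromReach zf
    ... | σ , rσ | τ , rτ = at-top σ rσ (occ-singleton (σ ++ τ) v (occ-cancel-prefix α (σ ++ τ) (v ∷ [])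
            (shot-invariance (run-++ rα (run-++ rσ rτ)) (run-++ rα once))))
      where
      -- the word σ ++ τ is v ∷ [] and σ is nonempty, so τ is empty
      at-top : ∀ σ → Run m σ z → σ ++ τ ≡ v ∷ [] → z ≡ fire E m v
      at-top []       r _    = ⊥-elim (m≢z (run-empty r refl))
      at-top (_ ∷ σ') _ same = run-empty rτ (++-conicalʳ σ' τ (∷-injectiveʳ same))

  meetIrr-firable-unique : ∀ {m v w} → IsMeetIrr m → Firable E m v → Firable E m w → v ≡ w
  meetIrr-firable-unique {m} {v} {w} (inL , _ , _ , unique) fv fw =
    fire-injective m v w fv (trans (unique _ (firing-covers inL fv)) (sym (unique _ (firing-covers inL fw))))

  -- A run from a meet-irreducible element that avoids its firable vertex is
  -- empty, since its first firing would give a second upper cover.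
  meetIrr-avoiding-run : ∀ {m v l e} → IsMeetIrr m → Firable E m v → Run m l e → occ l v ≡ 0 → m ≡ e
  meetIrr-avoiding-run _   _  [] _ = refl
  meetIrr-avoiding-run irr fv (_∷_ {v = x} {xs = t} (fx , refl) _) avoids
    with meetIrr-firable-unique irr fx fv
  ... | refl = ⊥-elim (occ-head x t avoids)

  -- If c ≤ m but fire c v ≰ m, the run from c to m never fires v; hence v is
  -- firable at m, and v is fired once more at fire c v than at m.
  frak-firing : ∀ {c m v} → InL c → c ≤L m → ¬ (fire E c v ≤L m) → Firable E c v →
                Firable E m v × (∀ {γ α} → Run O γ (fire E c v) → Run O α m → occ γ v ≡ suc (occ α v))
  frak-firing {c} {m} {v} inL cm fired≰m fv with fromReach inL | fromReach cm
  ... | γ₀ , rγ₀ | δ , rδ with push-firing fv rδ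
  ...   | inj₂ (_ , r) = ⊥-elim (fired≰m (toReach r))
  ...   | inj₁ (avoids , fm , _) = fm , counts
    where
    open ≡-Reasoning
    counts : ∀ {γ α} → Run O γ (fire E c v) → Run O α m → occ γ v ≡ suc (occ α v)
    counts {γ} {α} rγ rα = begin
      occ γ v                      ≡⟨ shot-invariance rγ (run-++ rγ₀ ((fv , refl) ∷ [])) v ⟩
      occ (γ₀ ++ v ∷ []) v         ≡⟨ occ-snoc-self γ₀ v ⟩
      suc (occ γ₀ v)               ≡⟨ cong suc (sym (+-identityʳ (occ γ₀ v))) ⟩
      suc (occ γ₀ v + 0)           ≡⟨ cong (λ k → suc (occ γ₀ v + k)) (sym avoids) ⟩
      suc (occ γ₀ v + occ δ v)     ≡⟨ cong suc (sym (occ-++ γ₀ δ v)) ⟩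
      suc (occ (γ₀ ++ δ) v)        ≡⟨ cong suc (shot-invariance (run-++ rγ₀ rδ) rα v) ⟩
      suc (occ α v)                ∎

  κ-at : ∀ {m c c' v} → c ≺ c' → IsFrak c c' m → Fires E c v c' → (p : Exec E O c') →
         Firable E m v × (∀ {α} → Run O α m → shots p v ≡ suc (occ α v))
  κ-at (inL , _) ((_ , cm) , c'≰m) (fv , refl) p with frak-firing inL cm c'≰m fv
  ... | fm , counts = fm , λ rα → trans (shots-trace p _) (counts (trace-run p) rα)

  -- κ is defined on every meet-irreducible m: m ≺ u for its unique upper
  -- cover u, and m = 𝔪(m,u) since u ≰ m.
  κ-defined : (m : Config n) → IsMeetIrr m → ∃[ c ] ∃[ c' ] ((c ≺ c') × IsFrak c c' m)
  κ-defined m irr@(_ , u , m≺u@(inL , _ , (m≤u , m≢u) , _) , _) =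
    m , u , m≺u , (irr , ε) , λ u≤m → m≢u (reach-antisym inL m≤u u≤m)

  -- κ is well defined: both covers fire the unique firable vertex v of m,
  -- and in both cases s_{c'}(v) = s_m(v) + 1.
  κ-well-defined : (m c c' d d' : Config n) → c ≺ c' → IsFrak c c' m →
      d ≺ d' → IsFrak d d' m →
      (v w : Fin n) → Fires E c v c' → Fires E d w d' →
      (p : Exec E O c') → (q : Exec E O d') →
      (v ≡ w) × (shots p v ≡ shots q w)
  κ-well-defined _ _ _ _ _ cc' frak₁@((irr , _) , _) dd' frak₂ _ _ fv fw p q
    with κ-at cc' frak₁ fv p | κ-at dd' frak₂ fw q
  ... | fmv , count₁ | fmw , count₂ with meetIrr-firable-unique irr fmv fmw
  ... | refl = refl , trans (count₁ rα) (sym (count₂ rα))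
    where rα = proj₂ (fromReach (proj₁ irr))

  -- κ is injective: if κ(m₁) = κ(m₂) = (v, k) then m₁ and m₂ both fire v
  -- exactly k - 1 times, so the exchange runs joining them avoid v and are
  -- therefore empty.
  κ-injective : (m₁ m₂ c c' d d' : Config n) → c ≺ c' → IsFrak c c' m₁ →
      d ≺ d' → IsFrak d d' m₂ →
      (v w : Fin n) → Fires E c v c' → Fires E d w d' →
      (p : Exec E O c') → (q : Exec E O d') →
      v ≡ w → shots p v ≡ shots q w → m₁ ≡ m₂
  κ-injective _ _ _ _ _ _ cc' frak₁@((irr₁ , _) , _) dd' frak₂@((irr₂ , _) , _) v _ fv fw p q refl same-shots
    with κ-at cc' frak₁ fv p | κ-at dd' frak₂ fw q
  ... | fm₁ , count₁ | fm₂ , count₂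
    with fromReach (proj₁ irr₁) | fromReach (proj₁ irr₂)
  ... | α , rα | β , rβ with exchange rα rβ
  ... | e , r₁ , r₂ = trans (meetIrr-avoiding-run irr₁ fm₁ r₁ (avoids β α equal))
                            (sym (meetIrr-avoiding-run irr₂ fm₂ r₂ (avoids α β (sym equal))))
    where
    equal : occ α v ≡ occ β v
    equal = suc-injective (trans (sym (count₁ rα)) (trans same-shots (count₂ rβ)))
    avoids : ∀ xs ys → occ ys v ≡ occ xs v → occ (xs ∖ ys) v ≡ 0
    avoids xs ys eq = trans (occ-∖ xs ys v) (m≤n⇒m∸n≡0 (≤-reflexive (sym eq)))

mainTheorem11 : ∀ {n} (E : Graph n) (O : Config n) → Terminating E O →
    let open CFG E O in
    ((m : Config n) → IsMeetIrr m →
      ∃[ c ] ∃[ c' ] ((c ≺ c') × IsFrak c c' m))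
    ×
    ((m c c' d d' : Config n) → c ≺ c' → IsFrak c c' m →
      d ≺ d' → IsFrak d d' m →
      (v w : Fin n) → Fires E c v c' → Fires E d w d' →
      (p : Exec E O c') → (q : Exec E O d') →
      (v ≡ w) × (shots p v ≡ shots q w))
    ×
    ((m₁ m₂ c c' d d' : Config n) → c ≺ c' → IsFrak c c' m₁ →
      d ≺ d' → IsFrak d d' m₂ →
      (v w : Fin n) → Fires E c v c' → Fires E d w d' →
      (p : Exec E O c') → (q : Exec E O d') →
      v ≡ w → shots p v ≡ shots q w → m₁ ≡ m₂)
mainTheorem11 E O term = κ-defined , κ-well-defined , κ-injective
  where open TerminatingGame E O term
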